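{- Let $G$ be a finite simple graph and $X_0,X_1,\dots,X_{k+1}$ a nice path decomposition of $G$. The collection $\mathcal F$ returned by the Zero Forcing Set Algorithm (described in the context) on input $G$ and this decomposition is a fort packing of $G$, i.e. a collection of pairwise disjoint forts.
   Context: A fort of $G=(V,E)$ is a set $F\subseteq V$ such that no vertex of $V\setminus F$ has exactly one neighbour in $F$; a fort packing is a collection of pairwise disjoint forts. Zero forcing: a blue vertex $u$ may force a white neighbour $v$ if $v$ is the only white vertex in $N[u]$. An arc set of a graph $H=(U,F)$ is a set of ordered pairs $(u,v)$ with $uv\in F$, not containing both $(u,v)$ and $(v,u)$; it is a forcing arc set if it is a collection of vertex-disjoint directed paths and there is a zero forcing process on $H$ starting from its sources (in-degree zero vertices), each white vertex forced by exactly one vertex and all vertices ending blue, such that $(u,v)$ is an arc exactly when $u$ forces $v$. $\overleftarrow{A}=\{(v,u):(u,v)\in A\}$. A nice path decomposition of $G$ is a sequence $X_0,\dots,X_{k+1}\subseteq V$ with (D1) every edge contained in some $X_i$, $1\le i\le k$; (D2) if $v\in X_i\cap X_j$, $i<j$, then $v\in X_s$ for $i\le s\le j$; (D3) $X_0=X_{k+1}=\emptyset$, other $X_i$ nonempty; (D4) consecutive sets differ by adding or deleting exactly one vertex; and every vertex of $G$ lies in some $X_i$. Notation: $X_i^j=\bigcup_{\tau=i}^jX_\tau$, $G(i,j)=G[X_i^j]$; $\mathsf{White}(S,H)$ is the set of vertices of $H$ still white when the zero forcing process on $H$ from initial blue set $S$ can no longer force; $\mathsf{FAS}(S,H)$ is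 a fixed canonically chosen forcing arc set representing the zero forcing process on $H$ from $S$; $\mathsf{Sources}(A,U)$ is the set of vertices of $U$ of in-degree zero in $(U,A)$. The Zero Forcing Set Algorithm: (L1) $t\leftarrow0$, $S\leftarrow\emptyset$, $A\leftarrow\emptyset$, $\mathcal F\leftarrow\emptyset$. (L2) $z\leftarrow t$, $W\leftarrow\emptyset$. (L3) while $W=\emptyset$ and $z\le k$: $z\leftarrow z+1$, $W\leftarrow\mathsf{White}(X_t\cup X_z,G(t,z))$. (L4) $A\leftarrow\overleftarrow{A}$. (L5) $S\leftarrow\mathsf{Sources}(A,X_0^t)$. (L6) if $W\ne\emptyset$: add $W$ to $\mathcal F$; $S\leftarrow S\cup X_{z-1}$; $A'\leftarrow A\cup\mathsf{FAS}(X_t\cup X_{z-1},G(t,z))$; $A\leftarrow\{(u,v)\in A':v\notin X_z\}$; $t\leftarrow z$; go to (L2). (L7) if $W=\emptyset$: $A\leftarrow A\cup\mathsf{FAS}(X_t,G(t,z))$. (L8) return $S$ and $\mathcal F$. -}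

module Defs where

open import Data.Bool using (Bool; true; false; _∧_; _∨_; not; if_then_else_)
open import Data.Nat using (ℕ; zero; suc; _≤_; _<_; _≤ᵇ_; _∸_; _≡ᵇ_)
open import Data.Fin using (Fin; _≟_)
open import Data.Fin.Subset using (Subset; _∈_; _∉_; _∪_; _∩_; _─_; ⊥; ⁅_⁆; ∣_∣; Nonempty; Empty)
open import Data.Vec using (lookup; tabulate)
open import Data.Bool.ListAction using (any; all)
open import Data.List using (List; []; _∷_; _++_; allFin; upTo; filterᵇ; foldr; map; reverse)
open import Data.List.Relation.Unary.AllPairs using (AllPairs)
open import Data.List.Relation.Unary.All using (All)
open import Data.Product using (_×_; _,_; ∃; proj₁; proj₂)
open import Data.Sum using (_⊎_)
open import Relation.Binary.PropositionalEquality using (_≡_; _≢_)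
open import Relation.Nullary.Decidable using (⌊_⌋)

record Graph (n : ℕ) : Set where
  field
    adj    : Fin n → Fin n → Bool
    sym    : ∀ u v → adj u v ≡ adj v u
    irrefl : ∀ v → adj v v ≡ false
open Graph public

module _ {n : ℕ} (G : Graph n) where

  N : Fin n → Subset n
  N v = tabulate (adj G v)

  IsFort : Subset n → Set
  IsFort F = ∀ v → v ∉ F → ∣ N v ∩ F ∣ ≢ 1

  IsFortPacking : List (Subset n) → Set
  IsFortPacking 𝓕 = All IsFort 𝓕 × AllPairs (λ A B → Empty (A ∩ B)) 𝓕

  -- Nice path decompositions  X_0, …, X_{k+1}
  -- (indexed by ℕ; only the indices 0 … k+1 are constrained / used)

  record IsNicePathDecomposition (k : ℕ) (X : ℕ → Subset n) : Set where
    field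
      D1 : ∀ u v → adj G u v ≡ true →
             ∃ λ i → 1 ≤ i × i ≤ k × u ∈ X i × v ∈ X i
      D2 : ∀ v i s j → i ≤ s → s ≤ j → j ≤ suc k →
             v ∈ X i → v ∈ X j → v ∈ X s
      D3-first : X 0 ≡ ⊥
      D3-last  : X (suc k) ≡ ⊥
      D3-nonempty : ∀ i → 1 ≤ i → i ≤ k → Nonempty (X i)
      D4 : ∀ i → i ≤ k →
             (∃ λ v → v ∉ X i × X (suc i) ≡ X i ∪ ⁅ v ⁆)
           ⊎ (∃ λ v → v ∉ X (suc i) × X i ≡ X (suc i) ∪ ⁅ v ⁆)
      cover : ∀ v → ∃ λ i → i ≤ suc k × v ∈ X i

  mem : Subset n → Fin n → Bool
  mem = lookup

  anyV : (Fin n → Bool) → Bool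
  anyV p = any p (allFin n)

  allV : (Fin n → Bool) → Bool
  allV p = all p (allFin n)

  -- in G[U] with blue set B, the white vertex v can be forced:
  -- some blue u ∈ U adjacent to v has v as the only white vertex of N_{G[U]}[u]
  forcible : (U B : Subset n) → Fin n → Bool
  forcible U B v =
    mem U v ∧ not (mem B v) ∧
    anyV (λ u → mem U u ∧ mem B u ∧ adj G u v ∧
                allV (λ w → not (mem U w ∧ adj G u w ∧ not (mem B w))
                            ∨ ⌊ w ≟ v ⌋))

  zfStep : (U B : Subset n) → Subset n
  zfStep U B = tabulate (λ v → mem B v ∨ forcible U B v)

  applyN : ℕ → (Subset n → Subset n) → Subset n → Subset n
  applyN zero    f x = x
  applyN (suc m) f x = f (applyN m f x)

  -- final blue set of the zero forcing process on G[U] from S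
  -- (n rounds suffice: each non-stationary round adds a vertex)
  zfClosure : (S U : Subset n) → Subset n
  zfClosure S U = applyN n (zfStep U) (S ∩ U)

  White : (S U : Subset n) → Subset n
  White S U = U ─ zfClosure S U

  Arc : Set
  Arc = Fin n × Fin n

  rev : List Arc → List Arc
  rev = map (λ a → proj₂ a , proj₁ a)

  Sources : List Arc → Subset n → Subset n
  Sources A U = tabulate (λ v → mem U v ∧
                  not (any (λ a → mem U (proj₁ a) ∧ ⌊ proj₂ a ≟ v ⌋) A))

  bagUnion : (X : ℕ → Subset n) → ℕ → ℕ → Subset n
  bagUnion X i j = foldr _∪_ ⊥ (map X (filterᵇ (i ≤ᵇ_) (upTo (suc j))))

  isEmptyᵇ : Subset n → Bool
  isEmptyᵇ W = ∣ W ∣ ≡ᵇ 0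

  -- The Zero Forcing Set Algorithm.
  -- FAS(S, U) is the (canonically chosen) forcing arc set for the zero
  -- forcing process on G[U] from S; it is a parameter here.

  module Algorithm (k : ℕ) (X : ℕ → Subset n)
                   (FAS : Subset n → Subset n → List Arc) where

    innerLoop : ℕ → (t z : ℕ) → Subset n → ℕ × Subset n
    innerLoop zero    t z W = z , W
    innerLoop (suc f) t z W =
      if isEmptyᵇ W ∧ (z ≤ᵇ k)
      then innerLoop f t (suc z) (White (X t ∪ X (suc z)) (bagUnion X t (suc z)))
      else (z , W)

    outerLoop : ℕ → (t : ℕ) → List Arc → List (Subset n) → Subset n × List (Subset n)
    outerLoop zero    t A 𝓕 = ⊥ , 𝓕
    outerLoop (suc f) t A 𝓕 =
      let zW = innerLoop (suc (suc k)) t t ⊥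
          z  = proj₁ zW
          W  = proj₂ zW
          A₁ = rev A
          S  = Sources A₁ (bagUnion X 0 t)
      in if isEmptyᵇ W
         then (S , 𝓕)
         else outerLoop f z
                (filterᵇ (λ a → not (mem (X z) (proj₂ a)))
                  (A₁ ++ FAS (X t ∪ X (z ∸ 1)) (bagUnion X t z)))
                (𝓕 ++ (W ∷ []))

    -- output (S , 𝓕); the fuel k+3 exceeds the number of iterations
    -- (t strictly increases in each pass through (L6) and t ≤ k+1)
    run : Subset n × List (Subset n)
    run = outerLoop (suc (suc (suc k))) 0 [] []

    outputForts : List (Subset n)
    outputForts = proj₂ run

-- A set W output at a stage (t, z) consists of the vertices left white by zero forcing in
-- G[X_t ∪ … ∪ X_z] from X_t ∪ X_z. Such a vertex avoids X_t and X_z, so by the interpolation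
-- property (D2) every bag containing it has index strictly between t and z; as every edge lies
-- in a bag, all neighbours of W lie in X_t ∪ … ∪ X_z. A vertex outside W with exactly one
-- neighbour in W is therefore blue in the final colouring and could still force that
-- neighbour, which is impossible: W is a fort. The next stage starts at t := z, so the index
-- windows (t, z) of successive forts are disjoint, and since every vertex lies in some bag the
-- forts are pairwise disjoint.
module Submission where

open import Data.Bool using (Bool; true; false; T; T?; not; _∧_; _∨_)
open import Data.Bool.Properties using (T-≡; T-∧; T-∨)
open import Data.Empty using (⊥-elim)
open import Data.Fin using (Fin; _≟_)
open import Data.Fin.Subset using (Subset; _∈_; _∉_; _⊆_; _∪_; _∩_; _─_; _-_; ⊥; ∣_∣; Empty)
open import Data.Fin.Subset.Properties
  using ( _∈?_; _⊆?_; nonempty?; Empty-unique; ∉⊥; ∈⊤; ∣⊥∣≡0; ∣p∣≤n; ∣p∣≡n⇒p≡⊤; ∣⁅x⁆∣≡1; x∈⁅y⁆⇒x≡y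
        ; ⊆-antisym; p⊆q⇒∣p∣≤∣q∣; p⊂q⇒∣p∣<∣q∣; x∈p∩q⁺; x∈p∩q⁻; x∈p∪q⁺; x∈p∪q⁻
        ; x∈p∧x∉q⇒x∈p─q; p─q⊆p; x∈p∧x≢y⇒x∈p-y; x∈p⇒∣p-x∣<∣p∣ )
open import Data.List using (List; []; _∷_; _++_; allFin; foldr; map)
open import Data.List.Membership.Propositional using (lose) renaming (_∈_ to _∈ˡ_)
open import Data.List.Membership.Propositional.Properties using (∈-allFin; ∈-upTo⁺; ∈-upTo⁻; ∈-filter⁺; ∈-filter⁻)
open import Data.List.Relation.Unary.All as All using (All; []; _∷_)
open import Data.List.Relation.Unary.Any using (here; there)
open import Data.List.Relation.Unary.Any.Properties using (any⁺)
open import Data.List.Relation.Unary.AllPairs using ([]; _∷_)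
import Data.List.Relation.Unary.All.Properties as Allₚ
import Data.List.Relation.Unary.AllPairs.Properties as AllPairsₚ
open import Data.Nat using (ℕ; zero; suc; _≤_; _<_; _≤ᵇ_; z≤n; s≤s)
open import Data.Nat.Properties using (≤-refl; ≤-trans; ≤-antisym; <⇒≤; <⇒≱; ≮⇒≥; <-asym; <-≤-trans; ≤-pred; m≤n⇒m≤1+n; ≤ᵇ⇒≤; ≤⇒≤ᵇ; _<?_)
open import Data.Product using (_×_; _,_; ∃; proj₁; proj₂; uncurry)
open import Data.Sum using (_⊎_; inj₁; inj₂)
open import Data.Vec using (_∷_; here; there; lookup; tabulate)
open import Data.Vec.Properties using ([]=⇒lookup; lookup⇒[]=; lookup∘tabulate)
open import Defs hiding (sym)
open import Function using (_∘_; Equivalence)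
open import Relation.Binary.PropositionalEquality using (_≡_; refl; sym; trans; subst)
open import Relation.Nullary using (¬_; Dec; yes; no; contradiction)
open import Relation.Nullary.Decidable using (⌊_⌋)

open Equivalence using (to; from)

x∈p─q⇒x∉q : ∀ {n} {p q : Subset n} {x} → x ∈ p ─ q → x ∉ q
x∈p─q⇒x∉q {p = _ ∷ p} {_ ∷ q} (there x∈p─q) (there x∈q) = x∈p─q⇒x∉q {p = p} x∈p─q x∈q

module _ {n : ℕ} where

  T-lookup⁺ : ∀ {p : Subset n} {x} → x ∈ p → T (lookup p x)
  T-lookup⁺ x∈p = T-≡ .from ([]=⇒lookup x∈p)

  T-lookup⁻ : ∀ {p : Subset n} {x} → T (lookup p x) → x ∈ p
  T-lookup⁻ = lookup⇒[]= _ _ ∘ T-≡ .to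

  T-not-lookup⁺ : ∀ {p : Subset n} {x} → x ∉ p → T (not (lookup p x))
  T-not-lookup⁺ {p} {x} x∉p with lookup p x in eq
  ... | true  = x∉p (lookup⇒[]= x p eq)
  ... | false = _

  T-not-lookup⁻ : ∀ {p : Subset n} {x} → T (not (lookup p x)) → x ∉ p
  T-not-lookup⁻ t x∈p = subst (T ∘ not) ([]=⇒lookup x∈p) t

  ∈-tabulate⁺ : ∀ {g : Fin n → Bool} {x} → T (g x) → x ∈ tabulate g
  ∈-tabulate⁺ {g} {x} = T-lookup⁻ ∘ subst T (sym (lookup∘tabulate g x))

  ∈-tabulate⁻ : ∀ {g : Fin n → Bool} {x} → x ∈ tabulate g → T (g x)
  ∈-tabulate⁻ {g} {x} = subst T (lookup∘tabulate g x) ∘ T-lookup⁺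

  x∈p∧x∉p─q⇒x∈q : ∀ {p q : Subset n} {x} → x ∈ p → x ∉ p ─ q → x ∈ q
  x∈p∧x∉p─q⇒x∈q {q = q} {x} x∈p x∉p─q with x ∈? q
  ... | yes x∈q = x∈q
  ... | no  x∉q = contradiction (x∈p∧x∉q⇒x∈p─q x∈p x∉q) x∉p─q

  ⊈⇒∃∈∉ : ∀ {p q : Subset n} → ¬ (p ⊆ q) → ∃ λ x → x ∈ p × x ∉ q
  ⊈⇒∃∈∉ {p} {q} p⊈q with nonempty? (p ─ q)
  ... | yes (x , x∈p─q) = x , p─q⊆p p q x∈p─q , x∈p─q⇒x∉q {p = p} x∈p─q
  ... | no  p─q-empty   = contradiction (λ {x} x∈p → x∈p∧x∉p─q⇒x∈q x∈p (λ x∈p─q → p─q-empty (_ , x∈p─q))) p⊈q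

  x∈p⇒1≤∣p∣ : ∀ {p : Subset n} {x} → x ∈ p → 1 ≤ ∣ p ∣
  x∈p⇒1≤∣p∣ {p} {x} x∈p =
    subst (_≤ ∣ p ∣) (∣⁅x⁆∣≡1 x) (p⊆q⇒∣p∣≤∣q∣ (λ y∈⁅x⁆ → subst (_∈ p) (sym (x∈⁅y⁆⇒x≡y x y∈⁅x⁆)) x∈p))

  ∣p∣≡1⇒singleton : ∀ {p : Subset n} → ∣ p ∣ ≡ 1 → ∃ λ x → x ∈ p × (∀ {y} → y ∈ p → y ≡ x)
  ∣p∣≡1⇒singleton {p} ∣p∣≡1 with nonempty? p
  ... | no p-empty =
    contradiction (trans (sym (∣⊥∣≡0 n)) (subst (λ q → ∣ q ∣ ≡ 1) (Empty-unique p-empty) ∣p∣≡1)) λ ()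
  ... | yes (x , x∈p) = x , x∈p , unique
    where
      unique : ∀ {y} → y ∈ p → y ≡ x
      unique {y} y∈p with y ≟ x
      ... | yes y≡x = y≡x
      ... | no  y≢x = contradiction (x∈p⇒1≤∣p∣ (x∈p∧x≢y⇒x∈p-y y∈p y≢x))
                        (<⇒≱ (subst (∣ p - x ∣ <_) ∣p∣≡1 (x∈p⇒∣p-x∣<∣p∣ x∈p)))

module _ {n : ℕ} (G : Graph n) (X : ℕ → Subset n) where

  private
    ∈-⋃⁺ : ∀ {l : List ℕ} {i v} → i ∈ˡ l → v ∈ X i → v ∈ foldr _∪_ ⊥ (map X l)
    ∈-⋃⁺ (here refl) v∈Xi = x∈p∪q⁺ (inj₁ v∈Xi)
    ∈-⋃⁺ (there i∈l) v∈Xi = x∈p∪q⁺ (inj₂ (∈-⋃⁺ i∈l v∈Xi))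

    ∈-⋃⁻ : ∀ (l : List ℕ) {v} → v ∈ foldr _∪_ ⊥ (map X l) → ∃ λ i → i ∈ˡ l × v ∈ X i
    ∈-⋃⁻ []      v∈⊥ = contradiction v∈⊥ ∉⊥
    ∈-⋃⁻ (j ∷ l) v∈∪ with x∈p∪q⁻ (X j) _ v∈∪
    ... | inj₁ v∈Xj = j , here refl , v∈Xj
    ... | inj₂ v∈⋃ with ∈-⋃⁻ l v∈⋃
    ...   | i , i∈l , v∈Xi = i , there i∈l , v∈Xi

  ∈-bagUnion⁺ : ∀ {t i z v} → t ≤ i → i ≤ z → v ∈ X i → v ∈ bagUnion G X t z
  ∈-bagUnion⁺ {t} t≤i i≤z = ∈-⋃⁺ (∈-filter⁺ (T? ∘ (t ≤ᵇ_)) (∈-upTo⁺ (s≤s i≤z)) (≤⇒≤ᵇ t≤i))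

  ∈-bagUnion⁻ : ∀ {t z v} → v ∈ bagUnion G X t z → ∃ λ i → t ≤ i × i ≤ z × v ∈ X i
  ∈-bagUnion⁻ {t} v∈U with ∈-⋃⁻ _ v∈U
  ... | i , i∈l , v∈Xi with ∈-filter⁻ (T? ∘ (t ≤ᵇ_)) i∈l
  ...   | i∈upTo , t≤ᵇi = i , ≤ᵇ⇒≤ t i t≤ᵇi , ≤-pred (∈-upTo⁻ i∈upTo) , v∈Xi

module _ {n : ℕ} (G : Graph n) where

  zfStep-inflationary : ∀ U {B} → B ⊆ zfStep G U B
  zfStep-inflationary U x∈B = ∈-tabulate⁺ (T-∨ .from (inj₁ (T-lookup⁺ x∈B)))

  forcing-step : ∀ {U B u v} → u ∈ U → u ∈ B → v ∈ N G u → v ∈ U → v ∉ B →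
                 (∀ {w} → w ∈ U → w ∈ N G u → w ∉ B → w ≡ v) → v ∈ zfStep G U B
  forcing-step {U} {B} {u} {v} u∈U u∈B v∈Nu v∈U v∉B only-white =
    ∈-tabulate⁺ (∨-introʳ (∧-intro (T-lookup⁺ v∈U) (∧-intro (T-not-lookup⁺ v∉B)
      (any⁺ _ (lose (∈-allFin u) u-forces-v)))))
    where
      ∧-intro : ∀ {a b} → T a → T b → T (a ∧ b)
      ∧-intro ta tb = T-∧ .from (ta , tb)

      ∨-introʳ : ∀ {a b} → T b → T (a ∨ b)
      ∨-introʳ = T-∨ .from ∘ inj₂

      T-not-∨-⌊⌋ : ∀ {b} {P : Set} (P? : Dec P) → (¬ P → ¬ T b) → T (not b ∨ ⌊ P? ⌋)
      T-not-∨-⌊⌋ {false} _       _ = _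
      T-not-∨-⌊⌋ {true}  (yes _)  _ = _
      T-not-∨-⌊⌋ {true}  (no ¬p) ¬b = ¬b ¬p _

      no-other-white : ∀ w → T (not (mem G U w ∧ adj G u w ∧ not (mem G B w)) ∨ ⌊ w ≟ v ⌋)
      no-other-white w = T-not-∨-⌊⌋ (w ≟ v) λ w≢v t →
        let w∈U , t′ = T-∧ .to t
            u~w , w∉B = T-∧ .to t′
        in w≢v (only-white (T-lookup⁻ w∈U) (∈-tabulate⁺ u~w) (T-not-lookup⁻ w∉B))

      u-forces-v : T (mem G U u ∧ mem G B u ∧ adj G u v ∧
                      allV G (λ w → not (mem G U w ∧ adj G u w ∧ not (mem G B w)) ∨ ⌊ w ≟ v ⌋))
      u-forces-v = ∧-intro (T-lookup⁺ u∈U) (∧-intro (T-lookup⁺ u∈B) (∧-intro (∈-tabulate⁻ v∈Nu)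
        (Allₚ.all⁻ _ (All.universal no-other-white (allFin n)))))

  module _ {f : Subset n → Subset n} (inflationary : ∀ {B} → B ⊆ f B) where

    applyN-extensive : ∀ m {B} → B ⊆ applyN G m f B
    applyN-extensive zero    x∈B = x∈B
    applyN-extensive (suc m) x∈B = inflationary (applyN-extensive m x∈B)

    applyN-stable⊎large : ∀ m B → f (applyN G m f B) ⊆ applyN G m f B ⊎ m ≤ ∣ applyN G m f B ∣
    applyN-stable⊎large zero    B = inj₂ z≤n
    applyN-stable⊎large (suc m) B with f (applyN G m f B) ⊆? applyN G m f B
    ... | yes stable rewrite ⊆-antisym stable inflationary = inj₁ stable
    ... | no ¬stable with applyN-stable⊎large m B
    ...   | inj₁ stable = ⊥-elim (¬stable stable)
    ...   | inj₂ m≤∣·∣ = inj₂ (≤-trans (s≤s m≤∣·∣) (p⊂q⇒∣p∣<∣q∣ (inflationary , ⊈⇒∃∈∉ ¬stable)))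

    -- Each non-stable step adds an element, so after n steps the chain is stable or equals ⊤.
    applyN-fixed : ∀ B → f (applyN G n f B) ⊆ applyN G n f B
    applyN-fixed B {x} with applyN-stable⊎large n B
    ... | inj₁ stable = stable
    ... | inj₂ n≤∣·∣  = λ _ → subst (x ∈_) (sym (∣p∣≡n⇒p≡⊤ (≤-antisym (∣p∣≤n (applyN G n f B)) n≤∣·∣))) ∈⊤

  zfClosure-⊇ : ∀ S U → S ∩ U ⊆ zfClosure G S U
  zfClosure-⊇ S U = applyN-extensive (zfStep-inflationary U) n

  zfClosure-closed : ∀ S U → zfStep G U (zfClosure G S U) ⊆ zfClosure G S U
  zfClosure-closed S U = applyN-fixed (zfStep-inflationary U) (S ∩ U)

  fortPacking-snoc : ∀ {𝓕 W} → IsFortPacking G 𝓕 → IsFort G W → All (λ F → Empty (F ∩ W)) 𝓕 →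
                     IsFortPacking G (𝓕 ++ W ∷ [])
  fortPacking-snoc (forts , disjoint) W-fort W-disjoint =
    Allₚ.++⁺ forts (W-fort ∷ []) , AllPairsₚ.++⁺ disjoint ([] ∷ []) (All.map (_∷ []) W-disjoint)

  White-isFort : ∀ S U → (∀ {v w} → w ∈ N G v → w ∈ White G S U → v ∈ U) → IsFort G (White G S U)
  White-isFort S U neighbours-inside v v∉W ∣Nv∩W∣≡1 with ∣p∣≡1⇒singleton ∣Nv∩W∣≡1
  ... | w , w∈Nv∩W , unique with x∈p∩q⁻ (N G v) _ w∈Nv∩W
  ...   | w∈Nv , w∈W = x∈p─q⇒x∉q {p = U} w∈W (zfClosure-closed S U w-forced)
    where
      v∈C : v ∈ zfClosure G S U
      v∈C = x∈p∧x∉p─q⇒x∈q (neighbours-inside w∈Nv w∈W) v∉W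

      w-forced : w ∈ zfStep G U (zfClosure G S U)
      w-forced = forcing-step (neighbours-inside w∈Nv w∈W) v∈C w∈Nv (p─q⊆p U _ w∈W) (x∈p─q⇒x∉q {p = U} w∈W)
        λ w′∈U w′∈Nv w′∉C → unique (x∈p∩q⁺ (w′∈Nv , x∈p∧x∉q⇒x∈p─q w′∈U w′∉C))

module _ {n : ℕ} {G : Graph n} {k : ℕ} {X : ℕ → Subset n} (nice : IsNicePathDecomposition G k X) where

  open IsNicePathDecomposition nice

  BagsAbove BagsBelow : ℕ → Subset n → Set
  BagsAbove t W = ∀ {w i} → w ∈ W → i ≤ suc k → w ∈ X i → t < i
  BagsBelow z W = ∀ {w i} → w ∈ W → i ≤ suc k → w ∈ X i → i < z

  bagsBelow-mono : ∀ {t z W} → t ≤ z → BagsBelow t W → BagsBelow z W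
  bagsBelow-mono t≤z below w∈W i≤1+k w∈Xi = <-≤-trans (below w∈W i≤1+k w∈Xi) t≤z

  bagsBelow∧bagsAbove⇒disjoint : ∀ {t A B} → BagsBelow t A → BagsAbove t B → Empty (A ∩ B)
  bagsBelow∧bagsAbove⇒disjoint below above (v , v∈A∩B) with x∈p∩q⁻ _ _ v∈A∩B | cover v
  ... | v∈A , v∈B | i , i≤1+k , v∈Xi = <-asym (below v∈A i≤1+k v∈Xi) (above v∈B i≤1+k v∈Xi)

  bags-strictly-between : ∀ {v t s z i} → t ≤ s → s ≤ z → z ≤ suc k → v ∈ X s →
                          v ∉ X t → v ∉ X z → i ≤ suc k → v ∈ X i → t < i × i < z
  bags-strictly-between {v} {t} {s} {z} {i} t≤s s≤z z≤1+k v∈Xs v∉Xt v∉Xz i≤1+k v∈Xi = t<i , i<z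
    where
      t<i : t < i
      t<i with t <? i
      ... | yes t<i = t<i
      ... | no  t≮i = contradiction (D2 v i t s (≮⇒≥ t≮i) t≤s (≤-trans s≤z z≤1+k) v∈Xi v∈Xs) v∉Xt

      i<z : i < z
      i<z with i <? z
      ... | yes i<z = i<z
      ... | no  i≮z = contradiction (D2 v s z i s≤z (≮⇒≥ i≮z) i≤1+k v∈Xs v∈Xi) v∉Xz

  windowWhite : ℕ → ℕ → Subset n
  windowWhite t z = White G (X t ∪ X z) (bagUnion G X t z)

  windowWhite-between : ∀ {t z} → z ≤ suc k → ∀ {w i} → w ∈ windowWhite t z →
                        i ≤ suc k → w ∈ X i → t < i × i < z
  windowWhite-between {t} {z} z≤1+k {w} w∈W with ∈-bagUnion⁻ G X (p─q⊆p _ _ w∈W)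
  ... | s , t≤s , s≤z , w∈Xs = bags-strictly-between t≤s s≤z z≤1+k w∈Xs (w∉S ∘ inj₁) (w∉S ∘ inj₂)
    where
      w∉S : ¬ (w ∈ X t ⊎ w ∈ X z)
      w∉S w∈S = x∈p─q⇒x∉q {p = bagUnion G X t z} w∈W
                  (zfClosure-⊇ G (X t ∪ X z) _ (x∈p∩q⁺ (x∈p∪q⁺ w∈S , p─q⊆p _ _ w∈W)))

  windowWhite-isFort : ∀ {t z} → z ≤ suc k → IsFort G (windowWhite t z)
  windowWhite-isFort {t} {z} z≤1+k = White-isFort G _ _ neighbours-inside
    where
      neighbours-inside : ∀ {v w} → w ∈ N G v → w ∈ windowWhite t z → v ∈ bagUnion G X t z
      neighbours-inside {v} {w} w∈Nv w∈W with D1 v w (T-≡ .to (∈-tabulate⁻ w∈Nv))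
      ... | i , _ , i≤k , v∈Xi , w∈Xi with windowWhite-between z≤1+k w∈W (m≤n⇒m≤1+n i≤k) w∈Xi
      ...   | t<i , i<z = ∈-bagUnion⁺ G X (<⇒≤ t<i) (<⇒≤ i<z) v∈Xi

  module _ (FAS : Subset n → Subset n → List (Arc G)) where

    open Algorithm G k X FAS

    record Candidate (t z : ℕ) (W : Subset n) : Set where
      field
        t≤z    : t ≤ z
        z≤1+k  : z ≤ suc k
        isFort : IsFort G W
        above  : BagsAbove t W
        below  : BagsBelow z W

    emptyCandidate : ∀ {t} → t ≤ suc k → Candidate t t ⊥
    emptyCandidate t≤1+k = record
      { t≤z    = ≤-refl
      ; z≤1+k  = t≤1+k
      ; isFort = λ v _ ∣Nv∩⊥∣≡1 → let _ , w∈Nv∩⊥ , _ = ∣p∣≡1⇒singleton ∣Nv∩⊥∣≡1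
                                  in ∉⊥ (proj₂ (x∈p∩q⁻ (N G v) ⊥ w∈Nv∩⊥))
      ; above  = λ w∈⊥ → contradiction w∈⊥ ∉⊥
      ; below  = λ w∈⊥ → contradiction w∈⊥ ∉⊥
      }

    windowCandidate : ∀ {t z} → t ≤ z → z ≤ suc k → Candidate t z (windowWhite t z)
    windowCandidate t≤z z≤1+k = record
      { t≤z    = t≤z
      ; z≤1+k  = z≤1+k
      ; isFort = windowWhite-isFort z≤1+k
      ; above  = λ w∈W i≤1+k w∈Xi → proj₁ (windowWhite-between z≤1+k w∈W i≤1+k w∈Xi)
      ; below  = λ w∈W i≤1+k w∈Xi → proj₂ (windowWhite-between z≤1+k w∈W i≤1+k w∈Xi)
      }

    innerLoop-candidate : ∀ fuel {t z W} → Candidate t z W → uncurry (Candidate t) (innerLoop fuel t z W)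
    innerLoop-candidate zero c = c
    innerLoop-candidate (suc fuel) {t} {z} {W} c with isEmptyᵇ G W | z ≤ᵇ k in z≤ᵇk
    ... | false | _     = c
    ... | true  | false = c
    ... | true  | true  = innerLoop-candidate fuel
          (windowCandidate (m≤n⇒m≤1+n (Candidate.t≤z c)) (s≤s (≤ᵇ⇒≤ z k (T-≡ .from z≤ᵇk))))

    Invariant : ℕ → List (Subset n) → Set
    Invariant t 𝓕 = IsFortPacking G 𝓕 × All (BagsBelow t) 𝓕

    invariant-snoc : ∀ {t z W 𝓕} → Invariant t 𝓕 → Candidate t z W → Invariant z (𝓕 ++ W ∷ [])
    invariant-snoc {t} {z} {W} (packing , 𝓕-below) c =
      fortPacking-snoc G packing isFort (All.map disjoint-from-W 𝓕-below) ,
      Allₚ.++⁺ (All.map (bagsBelow-mono t≤z) 𝓕-below) (below ∷ [])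
      where
        open Candidate c

        disjoint-from-W : ∀ {F} → BagsBelow t F → Empty (F ∩ W)
        disjoint-from-W F-below = bagsBelow∧bagsAbove⇒disjoint F-below above

    outerLoop-packing : ∀ fuel t A 𝓕 → t ≤ suc k → Invariant t 𝓕 →
                        IsFortPacking G (proj₂ (outerLoop fuel t A 𝓕))
    outerLoop-packing zero       t A 𝓕 t≤1+k inv = proj₁ inv
    outerLoop-packing (suc fuel) t A 𝓕 t≤1+k inv
      with innerLoop (suc (suc k)) t t ⊥ | innerLoop-candidate (suc (suc k)) (emptyCandidate t≤1+k)
    ... | z , W | c with isEmptyᵇ G W
    ...   | true  = proj₁ inv
    ...   | false = outerLoop-packing fuel z _ _ (Candidate.z≤1+k c) (invariant-snoc inv c)

theorem4p9 : ∀ {n : ℕ} (G : Graph n) (k : ℕ) (X : ℕ → Subset n)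
    → IsNicePathDecomposition G k X
    → (FAS : Subset n → Subset n → List (Arc G))
    → IsFortPacking G (Algorithm.outputForts G k X FAS)
theorem4p9 G k X nice FAS = outerLoop-packing nice FAS (suc (suc (suc k))) 0 [] [] z≤n (([] , []) , [])
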